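{- Every finite poset of dimension $2$ is diametrally reversing.
   Context: The dimension of a finite poset is the minimum number of linear extensions whose intersection is the poset order. A linear extension (LE) of a finite poset is a linear order of its ground set compatible with the poset order; the distance between two LEs is the number of pairs of elements appearing in different orders in them. A diametral pair is a pair of LEs of maximum distance; an LE is diametral if it belongs to some diametral pair. For $u$ let $\downarrow u$ (resp. $\uparrow u$) be the set of elements strictly smaller (resp. larger) than $u$. An ordered pair $(u,v)$ is a critical pair if $u,v$ are incomparable, $\downarrow u\subseteq\downarrow v$ and $\uparrow v\subseteq\uparrow u$. An LE reverses $(u,v)$ if $v$ precedes $u$ in it; it is reversing if it reverses some critical pair. A poset is diametrally reversing if every diametral LE is reversing. -}

module Defs where

open import Level using (Level; suc; _⊔_)
open import Data.Nat as ℕ using (ℕ)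
open import Data.Fin using (Fin) renaming (_<_ to _<ᶠ_; _≤_ to _≤ᶠ_)
open import Data.Fin.Properties using () renaming (_<?_ to _<ᶠ?_)
open import Data.List using (List; map; allFin)
open import Data.Nat.ListAction using (sum)
open import Data.Bool using (if_then_else_)
open import Data.Product using (Σ; ∃; _×_; ∃-syntax)
open import Function using (Injective; _⇔_)
open import Relation.Binary.PropositionalEquality using (_≡_)
open import Relation.Binary.Structures using (IsDecPartialOrder)
open import Relation.Nullary using (¬_; does)
open import Relation.Nullary.Decidable using (_×-dec_)

record FinPoset ℓ : Set (suc ℓ) where
  field
    n     : ℕ
    _≼_   : Fin n → Fin n → Set ℓ
    isDPO : IsDecPartialOrder _≡_ _≼_

module _ {ℓ} (P : FinPoset ℓ) where
  open FinPoset P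

  _≺_ : Fin n → Fin n → Set ℓ
  x ≺ y = (x ≼ y) × ¬ (x ≡ y)

  Incomparable : Fin n → Fin n → Set ℓ
  Incomparable x y = ¬ (x ≼ y) × ¬ (y ≼ x)

  -- A linear extension: a linear order of the ground set, given by the
  -- position of each element (an injective, hence bijective, map
  -- Fin n → Fin n), compatible with the poset order.
  record LinExt : Set ℓ where
    field
      pos    : Fin n → Fin n
      inj    : Injective _≡_ _≡_ pos
      compat : ∀ {x y} → x ≺ y → pos x <ᶠ pos y
  open LinExt public

  -- distance: number of (unordered) pairs {x,y} in different orders in L and M;
  -- each such pair is counted once, as the ordered pair (x,y) with x before y in L.
  dist : LinExt → LinExt → ℕ
  dist L M = sum (map (λ x → sum (map (λ y →
      if does ((pos L x <ᶠ? pos L y) ×-dec (pos M y <ᶠ? pos M x)) then 1 else 0)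
      (allFin n))) (allFin n))

  DiametralPair : LinExt → LinExt → Set ℓ
  DiametralPair L M = ∀ (L′ M′ : LinExt) → dist L′ M′ ℕ.≤ dist L M

  Diametral : LinExt → Set ℓ
  Diametral L = ∃[ M ] DiametralPair L M

  CriticalPair : Fin n → Fin n → Set ℓ
  CriticalPair u v =
    Incomparable u v
    × (∀ w → w ≺ u → w ≺ v)
    × (∀ w → v ≺ w → u ≺ w)

  Reverses : LinExt → Fin n → Fin n → Set
  Reverses L u v = pos L v <ᶠ pos L u

  Reversing : LinExt → Set ℓ
  Reversing L = ∃[ u ] ∃[ v ] (CriticalPair u v × Reverses L u v)

  DiametrallyReversing : Set ℓ
  DiametrallyReversing = ∀ L → Diametral L → Reversing L

  Realizer : ℕ → Set ℓ
  Realizer k = Σ (Fin k → LinExt) λ Ls →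
    ∀ x y → (x ≼ y) ⇔ (∀ i → pos (Ls i) x ≤ᶠ pos (Ls i) y)

  HasDimension : ℕ → Set ℓ
  HasDimension k = Realizer k × (∀ m → m ℕ.< k → ¬ Realizer m)

-- Let {A, B} be a realizer. For every pair of linear extensions L, M, the sum
-- dist L M + dist M L counts the ordered pairs on which L and M disagree; only
-- incomparable pairs can be disagreed on, and A, B disagree on all of them.
-- Hence a diametral pair (L, M) disagrees on every incomparable pair. Any
-- incomparable pair x <_M y can be pushed down to a minimal u ≤ x incomparable
-- to y and then up to a maximal v ≥ y incomparable to u; (u, v) is then a
-- critical pair with u <_M v, so L reverses it.
module Submission where

open import Defs
open import Level using (Level)
open import Data.Bool using (if_then_else_)
open import Data.Fin using (Fin) renaming (_<_ to _<ᶠ_; _≤_ to _≤ᶠ_)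
import Data.Fin.Properties as Fin
open import Data.Fin.Patterns using (0F; 1F)
open import Data.Fin.Induction using (po-wellFounded; po-noetherian)
open import Data.List using (List; []; _∷_; map; allFin)
open import Data.List.Membership.Propositional using (_∈_)
open import Data.List.Membership.Propositional.Properties using (∈-allFin)
open import Data.List.Relation.Unary.Any using (here; there)
open import Data.Nat using (ℕ; _+_; _≤_; _<_; z≤n; s≤s; _≤?_)
import Data.Nat.Properties as ℕ
open import Algebra.Properties.CommutativeSemigroup ℕ.+-commutativeSemigroup using (interchange)
open import Data.Nat.ListAction using (sum)
open import Data.Product using (_×_; _,_; proj₁; proj₂; swap; ∃-syntax)
open import Data.Sum using (_⊎_; inj₁; inj₂)
open import Function using (flip; mk⇔; Equivalence)
open import Induction.WellFounded using (WellFounded; Acc; acc)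
open import Relation.Binary.Core using (Rel)
open import Relation.Binary.Structures using (IsDecPartialOrder)
open import Relation.Binary.Definitions using (Decidable; tri<; tri≈; tri>)
open import Relation.Binary.PropositionalEquality
  using (_≡_; refl; sym; trans; cong; cong₂; subst₂)
open import Relation.Nullary using (¬_; Dec; yes; no; does; contradiction)
open import Relation.Nullary.Decidable using (_×-dec_; ¬?)
open import Relation.Unary as U using (Pred)

module _ {a} {A : Set a} where

  sum-map-cong : ∀ {h k : A → ℕ} → (∀ x → h x ≡ k x) → ∀ xs →
                 sum (map h xs) ≡ sum (map k xs)
  sum-map-cong h≡k []       = refl
  sum-map-cong h≡k (x ∷ xs) = cong₂ _+_ (h≡k x) (sum-map-cong h≡k xs)

  sum-map-zero : ∀ (xs : List A) → sum (map (λ _ → 0) xs) ≡ 0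
  sum-map-zero []       = refl
  sum-map-zero (x ∷ xs) = sum-map-zero xs

  sum-map-+ : ∀ (h k : A → ℕ) xs →
              sum (map (λ x → h x + k x) xs) ≡ sum (map h xs) + sum (map k xs)
  sum-map-+ h k []       = refl
  sum-map-+ h k (x ∷ xs) =
    trans (cong (h x + k x +_) (sum-map-+ h k xs)) (interchange (h x) (k x) _ _)

  sum-map-mono : ∀ {h k : A → ℕ} → (∀ x → h x ≤ k x) → ∀ xs →
                 sum (map h xs) ≤ sum (map k xs)
  sum-map-mono h≤k []       = z≤n
  sum-map-mono h≤k (x ∷ xs) = ℕ.+-mono-≤ (h≤k x) (sum-map-mono h≤k xs)

  sum-map-mono-< : ∀ {h k : A → ℕ} → (∀ x → h x ≤ k x) → ∀ {x xs} → x ∈ xs →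
                   h x < k x → sum (map h xs) < sum (map k xs)
  sum-map-mono-< h≤k {xs = _ ∷ xs} (here refl)  h<k =
    ℕ.+-mono-<-≤ h<k (sum-map-mono h≤k xs)
  sum-map-mono-< h≤k {xs = y ∷ _}  (there x∈xs) h<k =
    ℕ.+-mono-≤-< (h≤k y) (sum-map-mono-< h≤k x∈xs h<k)

sum-map-comm : ∀ {a b} {A : Set a} {B : Set b} (h : A → B → ℕ) xs ys →
               sum (map (λ x → sum (map (h x) ys)) xs) ≡
               sum (map (λ y → sum (map (flip h y) xs)) ys)
sum-map-comm h []       ys = sym (sum-map-zero ys)
sum-map-comm h (x ∷ xs) ys =
  trans (cong (sum (map (h x) ys) +_) (sum-map-comm h xs ys))
        (sym (sum-map-+ (h x) (λ y → sum (map (flip h y) xs)) ys))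

module _ {n : ℕ} where

  ΣΣ : (Fin n → Fin n → ℕ) → ℕ
  ΣΣ h = sum (map (λ x → sum (map (h x) (allFin n))) (allFin n))

  ΣΣ-cong : ∀ {h k : Fin n → Fin n → ℕ} → (∀ x y → h x y ≡ k x y) → ΣΣ h ≡ ΣΣ k
  ΣΣ-cong h≡k = sum-map-cong (λ x → sum-map-cong (h≡k x) (allFin n)) (allFin n)

  ΣΣ-+ : ∀ (h k : Fin n → Fin n → ℕ) → ΣΣ (λ x y → h x y + k x y) ≡ ΣΣ h + ΣΣ k
  ΣΣ-+ h k = trans (sum-map-cong (λ x → sum-map-+ (h x) (k x) (allFin n)) (allFin n))
                   (sum-map-+ _ _ (allFin n))

  ΣΣ-transpose : ∀ (h : Fin n → Fin n → ℕ) → ΣΣ (flip h) ≡ ΣΣ h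
  ΣΣ-transpose h = sym (sum-map-comm h (allFin n) (allFin n))

  ΣΣ-mono-< : ∀ {h k : Fin n → Fin n → ℕ} → (∀ x y → h x y ≤ k x y) →
              ∀ x y → h x y < k x y → ΣΣ h < ΣΣ k
  ΣΣ-mono-< h≤k x y h<k =
    sum-map-mono-< (λ x′ → sum-map-mono (h≤k x′) (allFin n)) (∈-allFin x)
      (sum-map-mono-< (h≤k x) (∈-allFin y) h<k)

  minimal-element : ∀ {r q} {R : Rel (Fin n) r} {Q : Pred (Fin n) q} →
                    WellFounded R → Decidable R → U.Decidable Q →
                    ∀ {x} → Q x → ∃[ u ] (Q u × (∀ w → R w u → ¬ Q w))
  minimal-element {R = R} {Q} R-wf R? Q? {x} = go (R-wf x)
    where
    go : ∀ {x} → Acc R x → Q x → ∃[ u ] (Q u × (∀ w → R w u → ¬ Q w))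
    go {x} (acc smaller) qx with Fin.any? (λ w → R? w x ×-dec Q? w)
    ... | yes (w , wRx , qw) = go (smaller wRx) qw
    ... | no  none           = x , qx , λ w wRx qw → none (w , wRx , qw)

𝟙 : ∀ {a} {A : Set a} → Dec A → ℕ
𝟙 p = if does p then 1 else 0

𝟙-≤1 : ∀ {a} {A : Set a} (p : Dec A) → 𝟙 p ≤ 1
𝟙-≤1 (yes _) = ℕ.≤-refl
𝟙-≤1 (no  _) = z≤n

module _ {a b} {A : Set a} {B : Set b} where

  𝟙-+-≤1 : (p : Dec A) (q : Dec B) → (A → ¬ B) → 𝟙 p + 𝟙 q ≤ 1
  𝟙-+-≤1 (yes a) (yes b) exclusive = contradiction b (exclusive a)
  𝟙-+-≤1 (yes _) (no  _) _         = ℕ.≤-refl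
  𝟙-+-≤1 (no  _) q       _         = 𝟙-≤1 q

  𝟙-+-sound : (p : Dec A) (q : Dec B) → 1 ≤ 𝟙 p + 𝟙 q → A ⊎ B
  𝟙-+-sound (yes a) _       _ = inj₁ a
  𝟙-+-sound (no  _) (yes b) _ = inj₂ b

  𝟙-+-complete : (p : Dec A) (q : Dec B) → A ⊎ B → 1 ≤ 𝟙 p + 𝟙 q
  𝟙-+-complete (yes _)  _        _        = s≤s z≤n
  𝟙-+-complete (no  _)  (yes _)  _        = s≤s z≤n
  𝟙-+-complete (no  ¬a) (no  _)  (inj₁ a) = contradiction a ¬a
  𝟙-+-complete (no  _)  (no  ¬b) (inj₂ b) = contradiction b ¬b

  𝟙-cong : (A → B) → (B → A) → (p : Dec A) (q : Dec B) → 𝟙 p ≡ 𝟙 q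
  𝟙-cong _   _   (yes _) (yes _) = refl
  𝟙-cong _   g   (no ¬a) (yes b) = contradiction (g b) ¬a
  𝟙-cong f   _   (yes a) (no ¬b) = contradiction (f a) ¬b
  𝟙-cong _   _   (no _)  (no _)  = refl

module Poset {ℓ} (P : FinPoset ℓ) where
  open FinPoset P
  open IsDecPartialOrder isDPO
    using (isPartialOrder)
    renaming (_≤?_ to _≼?_; refl to ≼-refl; trans to ≼-trans)

  _≺?_ : Decidable (_≺_ P)
  x ≺? y = (x ≼? y) ×-dec ¬? (x Fin.≟ y)

  incomparable? : Decidable (Incomparable P)
  incomparable? x y = ¬? (x ≼? y) ×-dec ¬? (y ≼? x)

  incomparable-sym : ∀ {x y} → Incomparable P x y → Incomparable P y x
  incomparable-sym (x⋠y , y⋠x) = y⋠x , x⋠y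

  incomparable⇒≢ : ∀ {x y} → Incomparable P x y → ¬ x ≡ y
  incomparable⇒≢ (x⋠y , _) refl = x⋠y ≼-refl

  critical-pair-around : ∀ {x y} → Incomparable P x y →
                         ∃[ u ] ∃[ v ] (CriticalPair P u v × u ≼ x × y ≼ v)
  critical-pair-around {x} {y} x∥y = u , v , (incomparable-sym v∥u , down , up) , u≼x , y≼v
    where
    lower = minimal-element (po-wellFounded isPartialOrder) _≺?_
              (λ w → (w ≼? x) ×-dec incomparable? w y) (≼-refl , x∥y)
    u = proj₁ lower
    u≼x = proj₁ (proj₁ (proj₂ lower))
    u∥y = proj₂ (proj₁ (proj₂ lower))

    upper = minimal-element (po-noetherian isPartialOrder) (flip _≺?_)
              (λ w → (y ≼? w) ×-dec incomparable? w u) (≼-refl , incomparable-sym u∥y)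
    v = proj₁ upper
    y≼v = proj₁ (proj₁ (proj₂ upper))
    v∥u = proj₂ (proj₁ (proj₂ upper))

    down : ∀ w → _≺_ P w u → _≺_ P w v
    down w (w≼u , w≢u) with w ≼? y | y ≼? w
    ... | yes w≼y | _       = ≼-trans w≼y y≼v , λ { refl → proj₁ v∥u w≼u }
    ... | no  _   | yes y≼w = contradiction (≼-trans y≼w w≼u) (proj₂ u∥y)
    ... | no  w⋠y | no  y⋠w = contradiction (≼-trans w≼u u≼x , w⋠y , y⋠w)
                                (proj₂ (proj₂ lower) w (w≼u , w≢u))

    up : ∀ w → _≺_ P v w → _≺_ P u w
    up w (v≼w , v≢w) with u ≼? w | w ≼? u
    ... | yes u≼w | _       = u≼w , λ { refl → proj₁ v∥u v≼w }
    ... | no  _   | yes w≼u = contradiction (≼-trans v≼w w≼u) (proj₁ v∥u)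
    ... | no  u⋠w | no  w⋠u = contradiction (≼-trans y≼v v≼w , w⋠u , u⋠w)
                                (proj₂ (proj₂ upper) w (v≼w , v≢w))

  _<[_]_ : Fin n → LinExt P → Fin n → Set
  x <[ L ] y = pos L x <ᶠ pos L y

  _<[_]?_ : ∀ x (L : LinExt P) y → Dec (x <[ L ] y)
  x <[ L ]? y = pos L x Fin.<? pos L y

  <[]-asym : ∀ (L : LinExt P) {x y} → x <[ L ] y → ¬ y <[ L ] x
  <[]-asym L = ℕ.<-asym

  pos-mono : ∀ (L : LinExt P) {x y} → x ≼ y → pos L x ≤ᶠ pos L y
  pos-mono L {x} {y} x≼y with x Fin.≟ y
  ... | yes refl = ℕ.≤-refl
  ... | no  x≢y  = ℕ.<⇒≤ (compat L (x≼y , x≢y))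

  <[]-connex : ∀ (L : LinExt P) {x y} → ¬ x ≡ y → x <[ L ] y ⊎ y <[ L ] x
  <[]-connex L {x} {y} x≢y with Fin.<-cmp (pos L x) (pos L y)
  ... | tri< x<y _ _ = inj₁ x<y
  ... | tri≈ _ eq _  = contradiction (inj L eq) x≢y
  ... | tri> _ _ y<x = inj₂ y<x

  opposite⇒incomparable : ∀ (L M : LinExt P) {x y} → x <[ L ] y → y <[ M ] x →
                          Incomparable P x y
  opposite⇒incomparable L M {x} {y} x<y y<x = x⋠y , y⋠x
    where
    x⋠y : ¬ x ≼ y
    x⋠y x≼y = ℕ.<⇒≱ y<x (pos-mono M x≼y)
    y⋠x : ¬ y ≼ x
    y⋠x y≼x = ℕ.<⇒≱ x<y (pos-mono L y≼x)

  Discordant : LinExt P → LinExt P → Fin n → Fin n → Set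
  Discordant L M x y = x <[ L ] y × y <[ M ] x

  discordant? : ∀ (L M : LinExt P) x y → Dec (Discordant L M x y)
  discordant? L M x y = (x <[ L ]? y) ×-dec (y <[ M ]? x)

  discordant : LinExt P → LinExt P → Fin n → Fin n → ℕ
  discordant L M x y = 𝟙 (discordant? L M x y)

  discord : LinExt P → LinExt P → Fin n → Fin n → ℕ
  discord L M x y = discordant L M x y + discordant M L x y

  dist-sym : ∀ (L M : LinExt P) → dist P M L ≡ dist P L M
  dist-sym L M = trans (ΣΣ-cong transposed) (ΣΣ-transpose (discordant L M))
    where
    transposed : ∀ x y → discordant M L x y ≡ discordant L M y x
    transposed x y = 𝟙-cong swap swap (discordant? M L x y) (discordant? L M y x)

  ΣΣ-discord : ∀ (L M : LinExt P) → ΣΣ (discord L M) ≡ dist P L M + dist P L M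
  ΣΣ-discord L M =
    trans (ΣΣ-+ (discordant L M) (discordant M L)) (cong (dist P L M +_) (dist-sym L M))

  discord-≤1 : ∀ (L M : LinExt P) x y → discord L M x y ≤ 1
  discord-≤1 L M x y = 𝟙-+-≤1 (discordant? L M x y) (discordant? M L x y)
    λ (x<y , _) (_ , y<x) → <[]-asym L x<y y<x

  discord-sound : ∀ (L M : LinExt P) {x y} → 1 ≤ discord L M x y →
                  Discordant L M x y ⊎ Discordant M L x y
  discord-sound L M {x} {y} = 𝟙-+-sound (discordant? L M x y) (discordant? M L x y)

  discord-complete : ∀ (L M : LinExt P) {x y} → Discordant L M x y ⊎ Discordant M L x y →
                     1 ≤ discord L M x y
  discord-complete L M {x} {y} = 𝟙-+-complete (discordant? L M x y) (discordant? M L x y)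

  discord-incomparable : ∀ (L M : LinExt P) {x y} → 1 ≤ discord L M x y → Incomparable P x y
  discord-incomparable L M d with discord-sound L M d
  ... | inj₁ (x<y , y<x) = opposite⇒incomparable L M x<y y<x
  ... | inj₂ (x<y , y<x) = opposite⇒incomparable M L x<y y<x

  discord-flip : ∀ (L M : LinExt P) {x y} → 1 ≤ discord L M x y → x <[ M ] y → y <[ L ] x
  discord-flip L M d x<y with discord-sound L M d
  ... | inj₁ (_ , y<x) = contradiction y<x (<[]-asym M x<y)
  ... | inj₂ (_ , y<x) = y<x

  Discords-on-incomparables : LinExt P → LinExt P → Set ℓ
  Discords-on-incomparables L M = ∀ x y → Incomparable P x y → 1 ≤ discord L M x y

  realizer₂-⋠ : ((Ls , _) : Realizer P 2) → ∀ {x y} → ¬ x ≼ y →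
                y <[ Ls 0F ] x ⊎ y <[ Ls 1F ] x
  realizer₂-⋠ (Ls , realizes) {x} {y} x⋠y
    with pos (Ls 0F) x Fin.≤? pos (Ls 0F) y
       | pos (Ls 1F) x Fin.≤? pos (Ls 1F) y
  ... | no  x≰y | _       = inj₁ (ℕ.≰⇒> x≰y)
  ... | yes _   | no  x≰y = inj₂ (ℕ.≰⇒> x≰y)
  ... | yes x≤y | yes x≤′y = contradiction (Equivalence.from (realizes x y) both) x⋠y
    where
    both : ∀ i → pos (Ls i) x ≤ᶠ pos (Ls i) y
    both 0F = x≤y
    both 1F = x≤′y

  realizer₂-discords : ((Ls , _) : Realizer P 2) →
                       Discords-on-incomparables (Ls 0F) (Ls 1F)
  realizer₂-discords R@(Ls , _) x y (x⋠y , y⋠x)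
    with realizer₂-⋠ R x⋠y | realizer₂-⋠ R y⋠x
  ... | inj₁ y<x | inj₁ x<y = contradiction x<y (<[]-asym (Ls 0F) y<x)
  ... | inj₁ y<x | inj₂ x<y = discord-complete (Ls 0F) (Ls 1F) (inj₂ (x<y , y<x))
  ... | inj₂ y<x | inj₁ x<y = discord-complete (Ls 0F) (Ls 1F) (inj₁ (x<y , y<x))
  ... | inj₂ y<x | inj₂ x<y = contradiction x<y (<[]-asym (Ls 1F) y<x)

  diametral-discords : ∀ (A B L M : LinExt P) → Discords-on-incomparables A B →
                       DiametralPair P L M → Discords-on-incomparables L M
  diametral-discords A B L M AB-discords LM-diametral x y x∥y with 1 ≤? discord L M x y
  ... | yes discords = discords
  ... | no  agrees   = contradiction
    (ΣΣ-mono-< pointwise x y (ℕ.<-≤-trans (ℕ.≰⇒> agrees) (AB-discords x y x∥y)))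
    (ℕ.≤⇒≯ AB≤LM)
    where
    pointwise : ∀ x y → discord L M x y ≤ discord A B x y
    pointwise x y with 1 ≤? discord L M x y
    ... | yes d =
      ℕ.≤-trans (discord-≤1 L M x y) (AB-discords x y (discord-incomparable L M d))
    ... | no ¬d = ℕ.≤-trans (ℕ.≤-pred (ℕ.≰⇒> ¬d)) z≤n
    AB≤LM : ΣΣ (discord A B) ≤ ΣΣ (discord L M)
    AB≤LM = subst₂ _≤_ (sym (ΣΣ-discord A B)) (sym (ΣΣ-discord L M))
              (ℕ.+-mono-≤ (LM-diametral A B) (LM-diametral A B))

  critical-pair-around-ordered : ∀ (M : LinExt P) {x y} → Incomparable P x y → x <[ M ] y →
                                 ∃[ u ] ∃[ v ] (CriticalPair P u v × u <[ M ] v)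
  critical-pair-around-ordered M x∥y x<y with critical-pair-around x∥y
  ... | u , v , uv-critical , u≼x , y≼v =
    u , v , uv-critical , ℕ.≤-<-trans (pos-mono M u≼x) (ℕ.<-≤-trans x<y (pos-mono M y≼v))

  critical-pair-ordered-by : ∀ (M : LinExt P) {x y} → Incomparable P x y →
                             ∃[ u ] ∃[ v ] (CriticalPair P u v × u <[ M ] v)
  critical-pair-ordered-by M x∥y with <[]-connex M (incomparable⇒≢ x∥y)
  ... | inj₁ x<y = critical-pair-around-ordered M x∥y x<y
  ... | inj₂ y<x = critical-pair-around-ordered M (incomparable-sym x∥y) y<x

  chain-realizer : LinExt P → (∀ x y → ¬ Incomparable P x y) → Realizer P 1
  chain-realizer L comparable =
    (λ _ → L) , λ x y → mk⇔ (λ x≼y _ → pos-mono L x≼y) (λ x≤y → reflect (x≤y 0F))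
    where
    reflect : ∀ {x y} → pos L x ≤ᶠ pos L y → x ≼ y
    reflect {x} {y} x≤y with x ≼? y | y ≼? x
    ... | yes x≼y | _       = x≼y
    ... | no  x⋠y | no  y⋠x = contradiction (x⋠y , y⋠x) (comparable x y)
    ... | no  x⋠y | yes y≼x with y Fin.≟ x
    ...   | yes refl = ≼-refl
    ...   | no  y≢x  = contradiction x≤y (ℕ.<⇒≱ (compat L (y≼x , y≢x)))

  incomparable-pair : LinExt P → ¬ Realizer P 1 → ∃[ x ] ∃[ y ] Incomparable P x y
  incomparable-pair L no-realizer₁ with Fin.any? (λ x → Fin.any? (incomparable? x))
  ... | yes found = found
  ... | no  none  =
    contradiction (chain-realizer L λ x y x∥y → none (x , y , x∥y)) no-realizer₁

  diametral-reverses : Realizer P 2 → ∀ (L M : LinExt P) → DiametralPair P L M →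
                       ∀ {x y} → Incomparable P x y → x <[ M ] y → y <[ L ] x
  diametral-reverses R@(Ls , _) L M LM-diametral {x} {y} x∥y =
    discord-flip L M
      (diametral-discords (Ls 0F) (Ls 1F) L M (realizer₂-discords R) LM-diametral x y x∥y)

open Poset

mainTheorem9 : ∀ {ℓ : Level} (P : FinPoset ℓ) → HasDimension P 2 → DiametrallyReversing P
mainTheorem9 P (realizer₂ , no-realizer₁) L (M , LM-diametral)
  with incomparable-pair P L (no-realizer₁ 1 (s≤s (s≤s z≤n)))
... | x , y , x∥y with critical-pair-ordered-by P M x∥y
... | u , v , uv-critical , u<v =
  u , v , uv-critical ,
  diametral-reverses P realizer₂ L M LM-diametral (proj₁ uv-critical) u<v
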